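{- Let $r\ge 1$ and $i\ge r$ be integers. Then $\delta_r(i)>0$, the quantity $A(p_i)-W_{r-1}$ is positive, and \[ \frac{r}{A(p_i)}\le R_r(i)\le \frac{r}{A(p_i)-W_{r-1}}. \]
   Context: Let $p_1=2<p_2=3<p_3=5<\cdots$ be the primes in increasing order. For integers $m\ge0$ and $i\ge 0$, $\delta_m(i)$ denotes the natural density of the set of integers $n$ divisible by exactly $m$ primes from $\{p_1,\dots,p_i\}$. For $r\ge1$, $R_r(i):=\delta_{r-1}(i)/\delta_r(i)$ whenever $\delta_r(i)>0$. For real $y$, $A(y):=\sum_{p\le y,\ p \text{ prime}}\frac{1}{p-1}$, and for $N\ge0$, $W_N:=\sum_{j=1}^N\frac{1}{p_j-1}$ (the empty sum $0$ when $N=0$). -}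

module Defs where

open import Data.Nat as ℕ using (ℕ; suc; _∸_)
open import Data.Nat.Primality using (Prime; prime?)
open import Data.Nat.Divisibility using (_∣_; _∣?_)
open import Data.List using (List; upTo; filter; length; map; sum; foldr)
open import Data.Product using (Σ; _×_; _,_)
open import Data.Integer using (+_)
open import Data.Rational using (ℚ; 0ℚ; 1ℚ; _+_; _-_; _<_; ∣_∣; _/_; 1/_; _*_; >-nonZero)
open import Relation.Nullary.Decidable using (_×-dec_)
open import Relation.Unary using (Pred; Decidable)
open import Relation.Binary.PropositionalEquality using (_≡_)
open import Level using (0ℓ)

oneTo : ℕ → List ℕ
oneTo x = map suc (upTo x)

primeCount : ℕ → ℕ
primeCount y = length (filter prime? (oneTo y))

-- q is the k-th prime p_k (p_1 = 2)
IsNthPrime : ℕ → ℕ → Set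
IsNthPrime k q = Prime q × primeCount q ≡ k

A : ℕ → ℚ
A y = foldr (λ p acc → inv p + acc) 0ℚ (filter prime? (oneTo y))
  where
  inv : ℕ → ℚ
  inv p with p ∸ 1
  ... | ℕ.zero = 0ℚ   -- never used: primes are ≥ 2
  ... | suc k = (+ 1) / suc k

ωUpTo : ℕ → ℕ → ℕ
ωUpTo q n = length (filter (λ p → prime? p ×-dec (p ∣? n)) (oneTo q))

-- n is divisible by exactly m primes among those ≤ q
-- (with q = p_i these are exactly the primes p_1, ..., p_i)
ExactlyDiv : ℕ → ℕ → Pred ℕ 0ℓ
ExactlyDiv m q n = ωUpTo q n ≡ m

ExactlyDiv? : ∀ m q → Decidable (ExactlyDiv m q)
ExactlyDiv? m q n = ωUpTo q n ℕ.≟ m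

countUpTo : {P : Pred ℕ 0ℓ} → Decidable P → ℕ → ℕ
countUpTo P? x = length (filter P? (oneTo x))

IsNaturalDensity : {P : Pred ℕ 0ℓ} → Decidable P → ℚ → Set
IsNaturalDensity P? d =
  ∀ (ε : ℚ) → 0ℚ < ε → Σ ℕ λ N → ∀ (x : ℕ) → N ℕ.≤ x →
    ∣ ((+ countUpTo P? (suc x)) / suc x) - d ∣ < ε

divPos : ℚ → (d : ℚ) → 0ℚ < d → ℚ
divPos a d pos = a * (1/ d) {{>-nonZero pos}}

{-# OPTIONS --safe #-}
module Submission where

-- The set of n divisible by exactly m of the primes p ≤ q = p_i is periodic modulo M = ∏_{p ≤ q} p,
-- so its density is its count in [0, M) divided by M. By the Chinese remainder theorem these counts
-- satisfy c(p ∷ L, m + 1) = c(L, m) + (p − 1) c(L, m + 1), whence δ_m = ∏ (1 − 1/p) · e_m(x₁, …, x_i)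
-- with x_j = 1/(p_j − 1) and e_m the m-th elementary symmetric polynomial. Since A(p_i) = x₁ + ⋯ + x_i
-- and W_{r−1} = x₁ + ⋯ + x_{r−1}, the two bounds on R_r = e_{r−1}/e_r are the Newton-type inequalities
-- r e_r ≤ (x₁ + ⋯ + x_i) e_{r−1} and (x_r + ⋯ + x_i) e_{r−1} ≤ r e_r, the second because the x_j decrease.

module FiniteSums where

  open import Data.Bool.Base using (true; false; if_then_else_)
  open import Data.Nat using (ℕ; zero; suc; _+_; _*_; _≤_; _<_; z≤n; s≤s)
  open import Data.Nat.Properties
  open import Data.Nat.Tactic.RingSolver using (solve-∀)
  open import Relation.Nullary using (Dec; does; yes; no; ¬_; contradiction)
  open import Relation.Binary.PropositionalEquality
  open import Function using (_∘_)
  open ≡-Reasoning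

  ∑< : ℕ → (ℕ → ℕ) → ℕ
  ∑< zero    f = 0
  ∑< (suc n) f = ∑< n f + f n

  syntax ∑< n (λ k → e) = ∑[ k < n ] e

  ∑<-cong : ∀ n {f g : ℕ → ℕ} → (∀ k → k < n → f k ≡ g k) → ∑< n f ≡ ∑< n g
  ∑<-cong zero    eq = refl
  ∑<-cong (suc n) eq = cong₂ _+_ (∑<-cong n (λ k k<n → eq k (m<n⇒m<1+n k<n))) (eq n ≤-refl)

  ∑<-const : ∀ n c → ∑[ _ < n ] c ≡ n * c
  ∑<-const zero    c = refl
  ∑<-const (suc n) c = trans (cong (_+ c) (∑<-const n c)) (+-comm (n * c) c)

  ∑<-zero : ∀ n {f : ℕ → ℕ} → (∀ k → k < n → f k ≡ 0) → ∑< n f ≡ 0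
  ∑<-zero n eq = trans (∑<-cong n eq) (trans (∑<-const n 0) (*-zeroʳ n))

  ∑<-+ : ∀ n f g → ∑[ k < n ] (f k + g k) ≡ ∑< n f + ∑< n g
  ∑<-+ zero    f g = refl
  ∑<-+ (suc n) f g = begin
    ∑[ k < n ] (f k + g k) + (f n + g n) ≡⟨ cong (_+ (f n + g n)) (∑<-+ n f g) ⟩
    ∑< n f + ∑< n g + (f n + g n)        ≡⟨ interchange (∑< n f) (∑< n g) (f n) (g n) ⟩
    ∑< n f + f n + (∑< n g + g n)        ∎
    where
    interchange : ∀ a b c d → a + b + (c + d) ≡ a + c + (b + d)
    interchange = solve-∀

  ∑<-*ˡ : ∀ n c f → ∑[ k < n ] (c * f k) ≡ c * ∑< n f
  ∑<-*ˡ zero    c f = sym (*-zeroʳ c)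
  ∑<-*ˡ (suc n) c f = trans (cong (_+ c * f n) (∑<-*ˡ n c f)) (sym (*-distribˡ-+ c (∑< n f) (f n)))

  ∑<-≤ : ∀ n {f : ℕ → ℕ} → (∀ k → f k ≤ 1) → ∑< n f ≤ n
  ∑<-≤ zero    f≤1 = z≤n
  ∑<-≤ (suc n) f≤1 = ≤-trans (+-mono-≤ (∑<-≤ n f≤1) (f≤1 n)) (≤-reflexive (+-comm n 1))

  ∑<-+-range : ∀ m n f → ∑< (m + n) f ≡ ∑< m f + ∑[ j < n ] f (m + j)
  ∑<-+-range m zero    f = trans (cong (λ l → ∑< l f) (+-identityʳ m)) (sym (+-identityʳ _))
  ∑<-+-range m (suc n) f = begin
    ∑< (m + suc n) f                                  ≡⟨ cong (λ l → ∑< l f) (+-suc m n) ⟩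
    ∑< (m + n) f + f (m + n)                          ≡⟨ cong (_+ f (m + n)) (∑<-+-range m n f) ⟩
    ∑< m f + ∑[ j < n ] f (m + j) + f (m + n)         ≡⟨ +-assoc (∑< m f) _ _ ⟩
    ∑< m f + (∑[ j < n ] f (m + j) + f (m + n))       ∎

  ∑<-suc-shift : ∀ n f → f n ≡ f 0 → ∑[ k < n ] f (suc k) ≡ ∑< n f
  ∑<-suc-shift n f fn≡f0 = +-cancelʳ-≡ _ _ _ (begin
    ∑[ k < n ] f (suc k) + f 0   ≡⟨ +-comm (∑[ k < n ] f (suc k)) (f 0) ⟩
    f 0 + ∑[ k < n ] f (suc k)   ≡⟨ sym (∑<-+-range 1 n f) ⟩
    ∑< n f + f n                 ≡⟨ cong (∑< n f +_) fn≡f0 ⟩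
    ∑< n f + f 0                 ∎)

  ∑<-blocks : ∀ k M g → ∑< (k * M) g ≡ ∑[ b < k ] ∑[ a < M ] g (b * M + a)
  ∑<-blocks zero    M g = refl
  ∑<-blocks (suc k) M g = begin
    ∑< (M + k * M) g                                       ≡⟨ cong (λ l → ∑< l g) (+-comm M (k * M)) ⟩
    ∑< (k * M + M) g                                       ≡⟨ ∑<-+-range (k * M) M g ⟩
    ∑< (k * M) g + ∑[ a < M ] g (k * M + a)                ≡⟨ cong (_+ ∑[ a < M ] g (k * M + a)) (∑<-blocks k M g) ⟩
    ∑[ b < k ] ∑[ a < M ] g (b * M + a) + ∑[ a < M ] g (k * M + a) ∎

  ∑<-comm : ∀ k M (h : ℕ → ℕ → ℕ) → ∑[ b < k ] ∑[ a < M ] h b a ≡ ∑[ a < M ] ∑[ b < k ] h b a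
  ∑<-comm zero    M h = sym (∑<-zero M (λ _ _ → refl))
  ∑<-comm (suc k) M h = begin
    ∑[ b < k ] ∑[ a < M ] h b a + ∑[ a < M ] h k a   ≡⟨ cong (_+ ∑[ a < M ] h k a) (∑<-comm k M h) ⟩
    ∑[ a < M ] ∑[ b < k ] h b a + ∑[ a < M ] h k a   ≡⟨ sym (∑<-+ M _ _) ⟩
    ∑[ a < M ] (∑[ b < k ] h b a + h k a)            ∎

  ∑<-periodic : ∀ k M s g → (∀ j → g (M + j) ≡ g j) → ∑< (k * M + s) g ≡ k * ∑< M g + ∑< s g
  ∑<-periodic k M s g per = begin
    ∑< (k * M + s) g                                       ≡⟨ ∑<-+-range (k * M) s g ⟩
    ∑< (k * M) g + ∑[ j < s ] g (k * M + j)                ≡⟨ cong₂ _+_ (∑<-blocks k M g) (∑<-cong s (λ j _ → shift k j)) ⟩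
    ∑[ b < k ] ∑[ a < M ] g (b * M + a) + ∑< s g           ≡⟨ cong (_+ ∑< s g) (∑<-cong k (λ b _ → ∑<-cong M (λ a _ → shift b a))) ⟩
    ∑[ _ < k ] ∑< M g + ∑< s g                             ≡⟨ cong (_+ ∑< s g) (∑<-const k (∑< M g)) ⟩
    k * ∑< M g + ∑< s g                                    ∎
    where
    shift : ∀ b a → g (b * M + a) ≡ g a
    shift zero    a = refl
    shift (suc b) a = trans (cong g (+-assoc M (b * M) a)) (trans (per _) (shift b a))

  ∑<-const-except : ∀ n {g : ℕ → ℕ} {b₀ y z} → b₀ < suc n → g b₀ ≡ y →
    (∀ b → b < suc n → b ≢ b₀ → g b ≡ z) → ∑< (suc n) g ≡ y + n * z
  ∑<-const-except zero    {y = y} (s≤s z≤n) gb₀ _ = trans gb₀ (sym (+-identityʳ y))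
  ∑<-const-except (suc m) {g} {b₀} {y} {z} b₀≤m+1 gb₀ gb with b₀ ≟ suc m
  ... | yes refl = begin
    ∑< (suc m) g + g (suc m) ≡⟨ cong₂ _+_ (∑<-cong (suc m) (λ b b<m+1 → gb b (m<n⇒m<1+n b<m+1) (<⇒≢ b<m+1))) gb₀ ⟩
    ∑[ _ < suc m ] z + y     ≡⟨ cong (_+ y) (∑<-const (suc m) z) ⟩
    suc m * z + y            ≡⟨ +-comm (suc m * z) y ⟩
    y + suc m * z            ∎
  ... | no b₀≢m+1 = begin
    ∑< (suc m) g + g (suc m) ≡⟨ cong₂ _+_ (∑<-const-except m (≤∧≢⇒< (≤-pred b₀≤m+1) b₀≢m+1) gb₀
                                                               (λ b b<m+1 → gb b (m<n⇒m<1+n b<m+1)))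
                                        (gb (suc m) ≤-refl (b₀≢m+1 ∘ sym)) ⟩
    y + m * z + z            ≡⟨ +-assoc y (m * z) z ⟩
    y + (m * z + z)          ≡⟨ cong (y +_) (+-comm (m * z) z) ⟩
    y + suc m * z            ∎

  -- Only does is inspected and ℕ's _≟_ decides via _≡ᵇ_, so 𝟙 (suc a ≟ suc m) reduces to 𝟙 (a ≟ m).
  𝟙 : ∀ {P : Set} → Dec P → ℕ
  𝟙 P? = if does P? then 1 else 0

  𝟙≤1 : ∀ {P : Set} (P? : Dec P) → 𝟙 P? ≤ 1
  𝟙≤1 P? with does P?
  ... | true  = ≤-refl
  ... | false = z≤n

  𝟙-yes : ∀ {P : Set} (P? : Dec P) → P → 𝟙 P? ≡ 1
  𝟙-yes (yes _) _ = refl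
  𝟙-yes (no ¬p) p = contradiction p ¬p

  𝟙-no : ∀ {P : Set} (P? : Dec P) → ¬ P → 𝟙 P? ≡ 0
  𝟙-no (yes p) ¬p = contradiction p ¬p
  𝟙-no (no _)  _  = refl

module PeriodicDensity where

  open import Data.Bool.Base using (true; false)
  open import Data.Nat as ℕ using (ℕ; zero; suc; _+_; _*_; _≤_; _<_; _⊔_; z≤n; s≤s)
  open import Data.Nat.Properties
  open import Data.Nat.DivMod using (_%_; _/_; m≡m%n+[m/n]*n; m%n<n)
  open import Data.Integer as ℤ using (+_; +0; +[1+_]; -[1+_]; _⊖_; +<+)
  import Data.Integer.Properties as ℤ
  import Data.Rational as ℚ
  import Data.Rational.Properties as ℚ
  import Data.Rational.Unnormalised as ℚᵘ
  import Data.Rational.Unnormalised.Properties as ℚᵘ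
  open import Data.List using ([_]; _++_; filter; length; map; upTo)
  open import Data.List.Properties using (filter-++; length-++; map-++; upTo-∷ʳ)
  open import Data.Product using (_,_)
  open import Relation.Nullary using (does)
  open import Function using (_∘_)
  open import Relation.Unary using (Pred; Decidable)
  open import Relation.Binary.PropositionalEquality hiding ([_])
  open import Data.Nat.Tactic.RingSolver using (solve-∀)
  open import Level using (0ℓ)
  open import Defs using (oneTo; countUpTo; IsNaturalDensity)
  open FiniteSums

  oneTo-suc : ∀ x → oneTo (suc x) ≡ oneTo x ++ [ suc x ]
  oneTo-suc x = trans (cong (map suc) (sym (upTo-∷ʳ x))) (map-++ suc (upTo x) [ x ])

  countUpTo≡∑𝟙 : ∀ {P : Pred ℕ 0ℓ} (P? : Decidable P) x → countUpTo P? x ≡ ∑[ k < x ] 𝟙 (P? (suc k))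
  countUpTo≡∑𝟙 P? zero    = refl
  countUpTo≡∑𝟙 P? (suc x) = begin
    length (filter P? (oneTo (suc x)))                  ≡⟨ cong (length ∘ filter P?) (oneTo-suc x) ⟩
    length (filter P? (oneTo x ++ [ suc x ]))           ≡⟨ cong length (filter-++ P? (oneTo x) [ suc x ]) ⟩
    length (filter P? (oneTo x) ++ filter P? [ suc x ]) ≡⟨ length-++ (filter P? (oneTo x)) ⟩
    countUpTo P? x + length (filter P? [ suc x ])       ≡⟨ cong₂ _+_ (countUpTo≡∑𝟙 P? x) (length-filter-[] (suc x)) ⟩
    ∑[ k < x ] 𝟙 (P? (suc k)) + 𝟙 (P? (suc x))          ∎
    where
    open ≡-Reasoning
    length-filter-[] : ∀ n → length (filter P? [ n ]) ≡ 𝟙 (P? n)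
    length-filter-[] n with does (P? n)
    ... | true  = refl
    ... | false = refl

  -- With X = k M + s the terms k (∑< M G) M cancel, leaving (∑< s G) M and (∑< M G) s, both at most M * M.
  periodic-deviation : ∀ (G : ℕ → ℕ) M X .{{_ : ℕ.NonZero M}} → (∀ k → G k ≤ 1) → (∀ j → G (M + j) ≡ G j) →
    ℤ.∣ ∑< X G * M ⊖ ∑< M G * X ∣ ≤ M * M
  periodic-deviation G M X G≤1 per = begin
    ℤ.∣ ∑< X G * M ⊖ ∑< M G * X ∣               ≡⟨ cong ℤ.∣_∣ (cong₂ _⊖_ ∑<X*M ∑<M*X) ⟩
    ℤ.∣ (k * c * M + u) ⊖ (k * c * M + v) ∣      ≡⟨ cong ℤ.∣_∣ (ℤ.+-cancelˡ-⊖ (k * c * M) u v) ⟩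
    ℤ.∣ u ⊖ v ∣                                  ≤⟨ ℤ.∣m⊝n∣≤m⊔n u v ⟩
    u ⊔ v                                        ≤⟨ ⊔-lub (*-monoˡ-≤ M (≤-trans (∑<-≤ s G≤1) s≤M)) (*-mono-≤ (∑<-≤ M G≤1) s≤M) ⟩
    M * M                                        ∎
    where
    open ≤-Reasoning
    k = X / M
    s = X % M
    c = ∑< M G
    u = ∑< s G * M
    v = c * s
    s≤M : s ≤ M
    s≤M = <⇒≤ (m%n<n X M)
    X≡kM+s : X ≡ k * M + s
    X≡kM+s = trans (m≡m%n+[m/n]*n X M) (+-comm s (k * M))
    ∑<X*M : ∑< X G * M ≡ k * c * M + u
    ∑<X*M = trans (cong (λ l → ∑< l G * M) X≡kM+s)
                  (trans (cong (_* M) (∑<-periodic k M s G per)) (expand k c (∑< s G) M))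
      where
      expand : ∀ k c t M → (k * c + t) * M ≡ k * c * M + t * M
      expand = solve-∀
    ∑<M*X : c * X ≡ k * c * M + v
    ∑<M*X = trans (cong (c *_) X≡kM+s) (expand k c M s)
      where
      expand : ∀ k c M s → c * (k * M + s) ≡ k * c * M + c * s
      expand = solve-∀

  ∣-∣<-crossMul : ∀ a c x m n d → ℤ.∣ a * suc m ⊖ c * suc x ∣ * suc d < suc n * (suc x * suc m) →
    ℚᵘ.∣ ℚᵘ.mkℚᵘ (+ a) x ℚᵘ.- ℚᵘ.mkℚᵘ (+ c) m ∣ ℚᵘ.< ℚᵘ.mkℚᵘ +[1+ n ] d
  ∣-∣<-crossMul a c x m n d lt = ℚᵘ.*<* (subst₂ ℤ._<_ lhs (ℤ.pos-* (suc n) (suc x * suc m)) (+<+ lt))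
    where
    numerator≡ : + a ℤ.* + suc m ℤ.+ ℤ.- (+ c) ℤ.* + suc x ≡ a * suc m ⊖ c * suc x
    numerator≡ = trans (cong₂ ℤ._+_ (sym (ℤ.pos-* a (suc m)))
                                    (trans (sym (ℤ.neg-distribˡ-* (+ c) (+ suc x))) (cong ℤ.-_ (sym (ℤ.pos-* c (suc x))))))
                       (ℤ.m-n≡m⊖n (a * suc m) (c * suc x))
    lhs : + (ℤ.∣ a * suc m ⊖ c * suc x ∣ * suc d)
        ≡ + ℤ.∣ + a ℤ.* + suc m ℤ.+ ℤ.- (+ c) ℤ.* + suc x ∣ ℤ.* + suc d
    lhs = trans (ℤ.pos-* ℤ.∣ a * suc m ⊖ c * suc x ∣ (suc d)) (cong (λ z → + ℤ.∣ z ∣ ℤ.* + suc d) (sym numerator≡))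

  periodic-density : ∀ {P : Pred ℕ 0ℓ} (P? : Decidable P) (G : ℕ → ℕ) m → (∀ x → countUpTo P? x ≡ ∑< x G) →
    (∀ k → G k ≤ 1) → (∀ j → G (suc m + j) ≡ G j) → IsNaturalDensity P? ((+ ∑< (suc m) G) ℚ./ suc m)
  periodic-density P? G m count≡∑ G≤1 per (ℚ.mkℚ +[1+ n ] d _) _ = suc m * suc d , close
    where
    M = suc m
    c = ∑< M G
    close : ∀ x → M * suc d ≤ x →
      ℚ.∣ (+ countUpTo P? (suc x)) ℚ./ suc x ℚ.- (+ c) ℚ./ M ∣ ℚ.< ℚ.mkℚ +[1+ n ] d _
    close x MD≤x rewrite count≡∑ (suc x) =
      ℚ.toℚᵘ-cancel-< (ℚᵘ.<-respˡ-≃ (ℚᵘ.≃-sym toℚᵘ-distance) (∣-∣<-crossMul a c x m n d crossMul<))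
      where
      X = suc x
      a = ∑< X G
      toℚᵘ-distance : ℚ.toℚᵘ ℚ.∣ (+ a) ℚ./ X ℚ.- (+ c) ℚ./ M ∣ ℚᵘ.≃ ℚᵘ.∣ ℚᵘ.mkℚᵘ (+ a) x ℚᵘ.- ℚᵘ.mkℚᵘ (+ c) m ∣
      toℚᵘ-distance = ℚᵘ.≃-trans (ℚ.toℚᵘ-homo-∣-∣ (U ℚ.- V)) (ℚᵘ.∣-∣-cong
        (ℚᵘ.≃-trans (ℚ.toℚᵘ-homo-+ U (ℚ.- V))
          (ℚᵘ.+-cong (ℚ.toℚᵘ-fromℚᵘ (ℚᵘ.mkℚᵘ (+ a) x))
            (ℚᵘ.≃-trans (ℚ.toℚᵘ-homo‿- V) (ℚᵘ.-‿cong (ℚ.toℚᵘ-fromℚᵘ (ℚᵘ.mkℚᵘ (+ c) m)))))))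
        where
        U = (+ a) ℚ./ X
        V = (+ c) ℚ./ M
      crossMul< : ℤ.∣ a * M ⊖ c * X ∣ * suc d < suc n * (X * M)
      crossMul< = begin-strict
        ℤ.∣ a * M ⊖ c * X ∣ * suc d ≤⟨ *-monoˡ-≤ (suc d) {ℤ.∣ a * M ⊖ c * X ∣} (periodic-deviation G M X G≤1 per) ⟩
        M * M * suc d              <⟨ m<m+n (M * M * suc d) {M} (s≤s z≤n) ⟩
        M * M * suc d + M          ≡⟨ regroup M (suc d) ⟩
        suc (M * suc d) * M        ≤⟨ *-monoˡ-≤ M (s≤s MD≤x) ⟩
        X * M                      ≤⟨ m≤m+n (X * M) (n * (X * M)) ⟩
        suc n * (X * M)            ∎
        where
        open ≤-Reasoning
        regroup : ∀ M D → M * M * D + M ≡ suc (M * D) * M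
        regroup = solve-∀
  periodic-density P? G m count≡∑ G≤1 per (ℚ.mkℚ +0       _ _) ε>0 with () ← ℚ.positive ε>0
  periodic-density P? G m count≡∑ G≤1 per (ℚ.mkℚ -[1+ _ ] _ _) ε>0 with () ← ℚ.positive ε>0

module ExactDivisorCount where

  open import Data.Nat using (ℕ; zero; suc; _+_; _*_; _∸_; _≤_; _<_; NonZero)
  open import Data.Nat.Properties
  open import Data.Nat.Divisibility
  open import Data.Nat.DivMod using (_%_; _/_; m≡m%n+[m/n]*n; m%n<n)
  open import Data.Nat.Primality using (Prime; euclidsLemma; prime⇒irreducible; ¬prime[1])
  open import Data.Nat.Coprimality using (Coprime; coprime-Bézout)
  open import Data.Nat.GCD using (module Bézout)
  open import Data.Nat.ListAction using (product)
  open import Data.List using (List; []; _∷_; filter; length)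
  open import Data.List.Relation.Unary.All as All using (All; []; _∷_)
  open import Data.Product using (∃; _,_; proj₁; proj₂)
  open import Data.Sum using (inj₁; inj₂)
  open import Data.Empty using (⊥-elim)
  open import Relation.Nullary using (yes; no; ¬_; contradiction)
  open import Relation.Binary.PropositionalEquality
  open import Function using (_∘_)
  open import Data.Nat.Tactic.RingSolver using (solve-∀)
  open FiniteSums
  open ≡-Reasoning

  ω : List ℕ → ℕ → ℕ
  ω L n = length (filter (_∣? n) L)

  ω-∷ : ∀ p L n → ω (p ∷ L) n ≡ 𝟙 (p ∣? n) + ω L n
  ω-∷ p L n with p ∣? n
  ... | yes _ = refl
  ... | no _  = refl

  ω-+-period : ∀ L c a → All (_∣ c) L → ω L (c + a) ≡ ω L a
  ω-+-period []      c a []          = refl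
  ω-+-period (ℓ ∷ L) c a (ℓ∣c ∷ L∣c) = begin
    ω (ℓ ∷ L) (c + a)               ≡⟨ ω-∷ ℓ L (c + a) ⟩
    𝟙 (ℓ ∣? c + a) + ω L (c + a)    ≡⟨ cong₂ _+_ same-indicator (ω-+-period L c a L∣c) ⟩
    𝟙 (ℓ ∣? a) + ω L a              ≡⟨ ω-∷ ℓ L a ⟨
    ω (ℓ ∷ L) a                     ∎
    where
    same-indicator : 𝟙 (ℓ ∣? c + a) ≡ 𝟙 (ℓ ∣? a)
    same-indicator with ℓ ∣? a
    ... | yes ℓ∣a = 𝟙-yes (ℓ ∣? c + a) (∣m∣n⇒∣m+n ℓ∣c ℓ∣a)
    ... | no ℓ∤a  = 𝟙-no (ℓ ∣? c + a) (ℓ∤a ∘ λ ℓ∣c+a → ∣m+n∣m⇒∣n ℓ∣c+a ℓ∣c)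

  ∣-product : ∀ L → All (_∣ product L) L
  ∣-product []      = []
  ∣-product (ℓ ∷ L) = m∣m*n (product L) ∷ All.map (∣n⇒∣m*n ℓ) (∣-product L)

  prime∤product : ∀ {p} L → Prime p → All Prime L → All (p <_) L → ¬ p ∣ product L
  prime∤product []      p-prime _                 _            p∣1 = ¬prime[1] (subst Prime (∣1⇒≡1 p∣1) p-prime)
  prime∤product (ℓ ∷ L) p-prime (ℓ-prime ∷ L-prime) (p<ℓ ∷ p<L) p∣ℓL with euclidsLemma ℓ (product L) p-prime p∣ℓL
  ... | inj₂ p∣L = prime∤product L p-prime L-prime p<L p∣L
  ... | inj₁ p∣ℓ with prime⇒irreducible ℓ-prime p∣ℓ
  ...   | inj₁ refl = ¬prime[1] p-prime
  ...   | inj₂ refl = <-irrefl refl p<ℓ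

  ∃-root : ∀ {p M} a → Prime p → ¬ p ∣ M → ∃ λ b → p ∣ b * M + a
  ∃-root {p@(suc p-1)} {M} a p-prime p∤M with coprime-Bézout M∼p
    where
    M∼p : Coprime M p
    M∼p (d∣M , d∣p) with prime⇒irreducible p-prime d∣p
    ... | inj₁ d≡1 = d≡1
    ... | inj₂ refl = ⊥-elim (p∤M d∣M)
  ... | Bézout.+- x y 1+yp≡xM = p-1 * a * x , divides (a + p-1 * a * y) (begin
    p-1 * a * x * M + a            ≡⟨ reassoc p-1 a x M ⟩
    p-1 * a * (x * M) + a          ≡⟨ cong (λ z → p-1 * a * z + a) 1+yp≡xM ⟨
    p-1 * a * (1 + y * p) + a      ≡⟨ expand p-1 a y ⟩
    (a + p-1 * a * y) * p          ∎)
    where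
    reassoc : ∀ c a x M → c * a * x * M + a ≡ c * a * (x * M) + a
    reassoc = solve-∀
    expand : ∀ c a y → c * a * (1 + y * suc c) + a ≡ (a + c * a * y) * suc c
    expand = solve-∀
  ... | Bézout.-+ x y 1+xM≡yp = a * x , divides (a * y) (begin
    a * x * M + a                  ≡⟨ factor a x M ⟩
    a * (1 + x * M)                ≡⟨ cong (a *_) 1+xM≡yp ⟩
    a * (y * p)                    ≡⟨ *-assoc a y p ⟨
    a * y * p                      ∎)
    where
    factor : ∀ a x M → a * x * M + a ≡ a * (1 + x * M)
    factor = solve-∀

  root-%-reduce : ∀ {p M a} b .{{_ : NonZero p}} → p ∣ b * M + a → p ∣ (b % p) * M + a
  root-%-reduce {p} {M} {a} b p∣bM+a = ∣m+n∣m⇒∣n (subst (p ∣_) split p∣bM+a) (n∣m*n ((b / p) * M))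
    where
    split : b * M + a ≡ (b / p) * M * p + ((b % p) * M + a)
    split = trans (cong (λ z → z * M + a) (m≡m%n+[m/n]*n b p)) (regroup (b % p) (b / p) p M a)
      where
      regroup : ∀ r q p M a → (r + q * p) * M + a ≡ q * M * p + (r * M + a)
      regroup = solve-∀

  root-unique-≤ : ∀ {p M a b₁ b₂} → Prime p → ¬ p ∣ M → b₁ ≤ b₂ → b₂ < p →
    p ∣ b₁ * M + a → p ∣ b₂ * M + a → b₁ ≡ b₂
  root-unique-≤ {p} {M} {a} {b₁} {b₂} p-prime p∤M b₁≤b₂ b₂<p p∣b₁M+a p∣b₂M+a
    with euclidsLemma (b₂ ∸ b₁) M p-prime p∣[b₂-b₁]M
    where
    p∣[b₂-b₁]M : p ∣ (b₂ ∸ b₁) * M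
    p∣[b₂-b₁]M = ∣m+n∣m⇒∣n (subst (p ∣_) split p∣b₂M+a) p∣b₁M+a
      where
      split : b₂ * M + a ≡ (b₁ * M + a) + (b₂ ∸ b₁) * M
      split = trans (cong (λ z → z * M + a) (sym (m+[n∸m]≡n b₁≤b₂))) (regroup b₁ (b₂ ∸ b₁) M a)
        where
        regroup : ∀ b d M a → (b + d) * M + a ≡ (b * M + a) + d * M
        regroup = solve-∀
  ... | inj₂ p∣M     = contradiction p∣M p∤M
  ... | inj₁ p∣b₂-b₁ = ≤-antisym b₁≤b₂ (m∸n≡0⇒m≤n (∣∧<⇒≡0 p∣b₂-b₁ (≤-<-trans (m∸n≤m b₂ b₁) b₂<p)))
    where
    ∣∧<⇒≡0 : ∀ {d} → p ∣ d → d < p → d ≡ 0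
    ∣∧<⇒≡0 {zero}  _   _   = refl
    ∣∧<⇒≡0 {suc d} p∣d d<p = contradiction p∣d (>⇒∤ d<p)

  root-unique : ∀ {p M a b₁ b₂} → Prime p → ¬ p ∣ M → b₁ < p → b₂ < p →
    p ∣ b₁ * M + a → p ∣ b₂ * M + a → b₁ ≡ b₂
  root-unique {b₁ = b₁} {b₂} p-prime p∤M b₁<p b₂<p p∣b₁M+a p∣b₂M+a with ≤-total b₁ b₂
  ... | inj₁ b₁≤b₂ = root-unique-≤ p-prime p∤M b₁≤b₂ b₂<p p∣b₁M+a p∣b₂M+a
  ... | inj₂ b₂≤b₁ = sym (root-unique-≤ p-prime p∤M b₂≤b₁ b₁<p p∣b₂M+a p∣b₁M+a)

  countExactly : List ℕ → ℕ → ℕ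
  countExactly L m = ∑[ n < product L ] 𝟙 (ω L n ≟ m)

  -- Exactly one b < p adds p to the prime divisors of b M + a; the others leave ω unchanged.
  fiber-count : ∀ {p-1 L} m a → Prime (suc p-1) → ¬ suc p-1 ∣ product L →
    ∑[ b < suc p-1 ] 𝟙 (ω (suc p-1 ∷ L) (b * product L + a) ≟ m) ≡ 𝟙 (suc (ω L a) ≟ m) + p-1 * 𝟙 (ω L a ≟ m)
  fiber-count {p-1} {L} m a p-prime p∤M =
    ∑<-const-except p-1 (m%n<n r p) (cong (λ i → 𝟙 (i ≟ m)) at-root) off-root
    where
    p = suc p-1
    M = product L
    r = proj₁ (∃-root a p-prime p∤M)
    b₀ = r % p
    p∣b₀M+a : p ∣ b₀ * M + a
    p∣b₀M+a = root-%-reduce r (proj₂ (∃-root a p-prime p∤M))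
    ω-fiber : ∀ b → ω (p ∷ L) (b * M + a) ≡ 𝟙 (p ∣? b * M + a) + ω L a
    ω-fiber b = trans (ω-∷ p L (b * M + a))
      (cong (𝟙 (p ∣? b * M + a) +_) (ω-+-period L (b * M) a (All.map (∣n⇒∣m*n b) (∣-product L))))
    at-root : ω (p ∷ L) (b₀ * M + a) ≡ suc (ω L a)
    at-root = trans (ω-fiber b₀) (cong (_+ ω L a) (𝟙-yes (p ∣? b₀ * M + a) p∣b₀M+a))
    off-root : ∀ b → b < p → b ≢ b₀ → 𝟙 (ω (p ∷ L) (b * M + a) ≟ m) ≡ 𝟙 (ω L a ≟ m)
    off-root b b<p b≢b₀ = cong (λ i → 𝟙 (i ≟ m)) (trans (ω-fiber b) (cong (_+ ω L a) (𝟙-no (p ∣? b * M + a)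
      (b≢b₀ ∘ λ p∣bM+a → root-unique p-prime p∤M b<p (m%n<n r p) p∣bM+a p∣b₀M+a))))

  countExactly-∷ : ∀ {p-1} L m → Prime (suc p-1) → ¬ suc p-1 ∣ product L →
    countExactly (suc p-1 ∷ L) m ≡ ∑[ a < product L ] 𝟙 (suc (ω L a) ≟ m) + p-1 * countExactly L m
  countExactly-∷ {p-1} L m p-prime p∤M = begin
    ∑< (p * M) g                                                        ≡⟨ ∑<-blocks p M g ⟩
    ∑[ b < p ] ∑[ a < M ] g (b * M + a)                                 ≡⟨ ∑<-comm p M (λ b a → g (b * M + a)) ⟩
    ∑[ a < M ] ∑[ b < p ] g (b * M + a)                                 ≡⟨ ∑<-cong M (λ a _ → fiber-count m a p-prime p∤M) ⟩
    ∑[ a < M ] (𝟙 (suc (ω L a) ≟ m) + p-1 * 𝟙 (ω L a ≟ m))             ≡⟨ ∑<-+ M _ _ ⟩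
    ∑[ a < M ] 𝟙 (suc (ω L a) ≟ m) + ∑[ a < M ] (p-1 * 𝟙 (ω L a ≟ m))  ≡⟨ cong (_ +_) (∑<-*ˡ M p-1 _) ⟩
    ∑[ a < M ] 𝟙 (suc (ω L a) ≟ m) + p-1 * countExactly L m            ∎
    where
    p = suc p-1
    M = product L
    g : ℕ → ℕ
    g n = 𝟙 (ω (p ∷ L) n ≟ m)

module RationalFacts where

  open import Data.Nat as ℕ using (ℕ; suc; s≤s)
  import Data.Nat.Properties as ℕ
  open import Data.Integer as ℤ using (+_)
  import Data.Integer.Properties as ℤ
  open import Data.Rational using (ℚ; 0ℚ; 1ℚ; _+_; _*_; _≤_; _<_; _/_; 1/_; nonNegative; positive; >-nonZero)
  open import Data.Rational.Properties
  import Data.Rational.Unnormalised as ℚᵘ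
  import Data.Rational.Unnormalised.Properties as ℚᵘ
  open import Data.Rational.Solver using (module +-*-Solver)
  open +-*-Solver using (solve; _:=_; _:*_)
  open import Relation.Binary.PropositionalEquality
  open import Defs using (divPos)

  ι : ℕ → ℚ
  ι n = + n / 1

  ι-+ : ∀ m n → ι (m ℕ.+ n) ≡ ι m + ι n
  ι-+ m n = toℚᵘ-injective (ℚᵘ.≃-trans (toℚᵘ-fromℚᵘ (ℚᵘ.mkℚᵘ (+ (m ℕ.+ n)) 0))
    (ℚᵘ.≃-sym (ℚᵘ.≃-trans (toℚᵘ-homo-+ (ι m) (ι n))
      (ℚᵘ.≃-trans (ℚᵘ.+-cong (toℚᵘ-fromℚᵘ (ℚᵘ.mkℚᵘ (+ m) 0)) (toℚᵘ-fromℚᵘ (ℚᵘ.mkℚᵘ (+ n) 0)))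
        (ℚᵘ.*≡* (cong (ℤ._* + 1) (trans (cong₂ ℤ._+_ (ℤ.*-identityʳ (+ m)) (ℤ.*-identityʳ (+ n)))
                                                     (sym (ℤ.pos-+ m n)))))))))

  ι-suc : ∀ n → ι (suc n) ≡ 1ℚ + ι n
  ι-suc = ι-+ 1

  ι-* : ∀ m n → ι (m ℕ.* n) ≡ ι m * ι n
  ι-* m n = toℚᵘ-injective (ℚᵘ.≃-trans (toℚᵘ-fromℚᵘ (ℚᵘ.mkℚᵘ (+ (m ℕ.* n)) 0))
    (ℚᵘ.≃-sym (ℚᵘ.≃-trans (toℚᵘ-homo-* (ι m) (ι n))
      (ℚᵘ.≃-trans (ℚᵘ.*-cong (toℚᵘ-fromℚᵘ (ℚᵘ.mkℚᵘ (+ m) 0)) (toℚᵘ-fromℚᵘ (ℚᵘ.mkℚᵘ (+ n) 0)))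
        (ℚᵘ.*≡* (cong (ℤ._* + 1) (sym (ℤ.pos-* m n))))))))

  /≡ι*1/ : ∀ n k → (+ n) / suc k ≡ ι n * (+ 1 / suc k)
  /≡ι*1/ n k = toℚᵘ-injective (ℚᵘ.≃-trans (toℚᵘ-fromℚᵘ (ℚᵘ.mkℚᵘ (+ n) k))
    (ℚᵘ.≃-sym (ℚᵘ.≃-trans (toℚᵘ-homo-* (ι n) (+ 1 / suc k))
      (ℚᵘ.≃-trans (ℚᵘ.*-cong (toℚᵘ-fromℚᵘ (ℚᵘ.mkℚᵘ (+ n) 0)) (toℚᵘ-fromℚᵘ (ℚᵘ.mkℚᵘ (+ 1) k)))
        (ℚᵘ.*≡* (trans (cong (ℤ._* + suc k) (ℤ.*-identityʳ (+ n))) (cong (λ d → + n ℤ.* + d) (sym (ℕ.*-identityˡ (suc k))))))))))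

  ι*1/≡1 : ∀ k → ι (suc k) * (+ 1 / suc k) ≡ 1ℚ
  ι*1/≡1 k = trans (sym (/≡ι*1/ (suc k) k)) (toℚᵘ-injective (ℚᵘ.≃-trans (toℚᵘ-fromℚᵘ (ℚᵘ.mkℚᵘ (+ suc k) k))
    (ℚᵘ.*≡* (trans (ℤ.*-identityʳ (+ suc k)) (sym (ℤ.*-identityˡ (+ suc k)))))))

  ι-pos : ∀ n .{{_ : ℕ.NonZero n}} → 0ℚ < ι n
  ι-pos n = positive⁻¹ _ {{normalize-pos n 1}}

  1/suc-pos : ∀ k → 0ℚ < + 1 / suc k
  1/suc-pos k = positive⁻¹ _ {{normalize-pos 1 (suc k)}}

  1/suc-antitone : ∀ {k k′} → k ℕ.≤ k′ → + 1 / suc k′ ≤ + 1 / suc k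
  1/suc-antitone {k} {k′} k≤k′ = toℚᵘ-cancel-≤ (ℚᵘ.≤-respˡ-≃ (ℚᵘ.≃-sym (toℚᵘ-fromℚᵘ (ℚᵘ.mkℚᵘ (+ 1) k′)))
    (ℚᵘ.≤-respʳ-≃ (ℚᵘ.≃-sym (toℚᵘ-fromℚᵘ (ℚᵘ.mkℚᵘ (+ 1) k))) (ℚᵘ.*≤* (ℤ.*-monoˡ-≤-nonNeg (+ 1) (ℤ.+≤+ (s≤s k≤k′))))))

  *-nonNeg : ∀ {a b} → 0ℚ ≤ a → 0ℚ ≤ b → 0ℚ ≤ a * b
  *-nonNeg {a} {b} 0≤a 0≤b = nonNegative⁻¹ _ {{nonNeg*nonNeg⇒nonNeg a {{nonNegative 0≤a}} b {{nonNegative 0≤b}}}}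

  *-pos : ∀ {a b} → 0ℚ < a → 0ℚ < b → 0ℚ < a * b
  *-pos {a} {b} 0<a 0<b = positive⁻¹ _ {{pos*pos⇒pos a {{positive 0<a}} b {{positive 0<b}}}}

  +-nonNeg : ∀ {a b} → 0ℚ ≤ a → 0ℚ ≤ b → 0ℚ ≤ a + b
  +-nonNeg {a} {b} 0≤a 0≤b = nonNegative⁻¹ _ {{nonNeg+nonNeg⇒nonNeg a {{nonNegative 0≤a}} b {{nonNegative 0≤b}}}}

  +-nonNeg-pos : ∀ {a b} → 0ℚ ≤ a → 0ℚ < b → 0ℚ < a + b
  +-nonNeg-pos {a} {b} 0≤a 0<b = positive⁻¹ _ {{nonNeg+pos⇒pos a {{nonNegative 0≤a}} b {{positive 0<b}}}}

  ≤-+-nonNeg : ∀ {a d} → 0ℚ ≤ d → a ≤ a + d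
  ≤-+-nonNeg {a} {d} 0≤d = subst (_≤ a + d) (+-identityʳ a) (+-monoʳ-≤ a 0≤d)

  *-monoˡ-≤ : ∀ {r p q} → 0ℚ ≤ r → p ≤ q → r * p ≤ r * q
  *-monoˡ-≤ {r} 0≤r = *-monoˡ-≤-nonNeg r {{nonNegative 0≤r}}

  *-monoʳ-≤ : ∀ {r p q} → 0ℚ ≤ r → p ≤ q → p * r ≤ q * r
  *-monoʳ-≤ {r} 0≤r = *-monoʳ-≤-nonNeg r {{nonNegative 0≤r}}

  divPos-*-cancel : ∀ a b (b>0 : 0ℚ < b) x → divPos a b b>0 * (b * x) ≡ a * x
  divPos-*-cancel a b b>0 x = begin
    a * b⁻¹ * (b * x)  ≡⟨ regroup a b⁻¹ b x ⟩
    a * x * (b * b⁻¹)  ≡⟨ cong (a * x *_) (*-inverseʳ b {{>-nonZero b>0}}) ⟩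
    a * x * 1ℚ         ≡⟨ *-identityʳ (a * x) ⟩
    a * x              ∎
    where
    open ≡-Reasoning
    b⁻¹ = (1/ b) {{>-nonZero b>0}}
    regroup : ∀ a b⁻¹ b x → a * b⁻¹ * (b * x) ≡ a * x * (b * b⁻¹)
    regroup = solve 4 (λ a b⁻¹ b x → a :* b⁻¹ :* (b :* x) := a :* x :* (b :* b⁻¹)) refl

  divPos-≤-crossMul : ∀ a c {b d} (b>0 : 0ℚ < b) (d>0 : 0ℚ < d) → a * d ≤ c * b → divPos a b b>0 ≤ divPos c d d>0
  divPos-≤-crossMul a c {b} {d} b>0 d>0 ad≤cb = *-cancelʳ-≤-pos (b * d) {{positive (*-pos b>0 d>0)}} (begin
    divPos a b b>0 * (b * d)  ≡⟨ divPos-*-cancel a b b>0 d ⟩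
    a * d                     ≤⟨ ad≤cb ⟩
    c * b                     ≡⟨ divPos-*-cancel c d d>0 b ⟨
    divPos c d d>0 * (d * b)  ≡⟨ cong (divPos c d d>0 *_) (*-comm d b) ⟩
    divPos c d d>0 * (b * d)  ∎)
    where open ≤-Reasoning

module ElementarySymmetric where

  open import Data.Nat as ℕ using (ℕ; zero; suc; s≤s)
  open import Data.Rational using (ℚ; 0ℚ; 1ℚ; _+_; _*_; _-_; _≤_; _<_)
  open import Data.Rational.Properties
  open import Data.Rational.Solver using (module +-*-Solver)
  open +-*-Solver using (solve; _:=_; _:+_; _:*_; _:-_; con)
  open import Data.List using (List; []; _∷_; _++_; foldr; drop; length)
  open import Data.List.Relation.Unary.All as All using (All; []; _∷_)
  open import Data.List.Relation.Unary.AllPairs using (AllPairs; []; _∷_)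
  open import Relation.Binary.PropositionalEquality
  open RationalFacts

  ∑ℚ : List ℚ → ℚ
  ∑ℚ = foldr _+_ 0ℚ

  e : List ℚ → ℕ → ℚ
  e xs       zero    = 1ℚ
  e []       (suc m) = 0ℚ
  e (x ∷ xs) (suc m) = e xs (suc m) + x * e xs m

  e-1 : ∀ xs → e xs 1 ≡ ∑ℚ xs
  e-1 []       = refl
  e-1 (x ∷ xs) = trans (cong₂ _+_ (e-1 xs) (*-identityʳ x)) (+-comm (∑ℚ xs) x)

  ∑ℚ-nonNeg : ∀ xs → All (0ℚ ≤_) xs → 0ℚ ≤ ∑ℚ xs
  ∑ℚ-nonNeg []       []           = ≤-refl
  ∑ℚ-nonNeg (x ∷ xs) (0≤x ∷ 0≤xs) = +-nonNeg 0≤x (∑ℚ-nonNeg xs 0≤xs)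

  e-nonNeg : ∀ xs m → All (0ℚ ≤_) xs → 0ℚ ≤ e xs m
  e-nonNeg xs       zero    _            = <⇒≤ (positive⁻¹ 1ℚ)
  e-nonNeg []       (suc m) _            = ≤-refl
  e-nonNeg (x ∷ xs) (suc m) (0≤x ∷ 0≤xs) = +-nonNeg (e-nonNeg xs (suc m) 0≤xs) (*-nonNeg 0≤x (e-nonNeg xs m 0≤xs))

  e-pos : ∀ xs m → All (0ℚ <_) xs → m ℕ.≤ length xs → 0ℚ < e xs m
  e-pos xs       zero    _            _       = positive⁻¹ 1ℚ
  e-pos (x ∷ xs) (suc m) (0<x ∷ 0<xs) (s≤s m≤) =
    +-nonNeg-pos (e-nonNeg xs (suc m) (All.map <⇒≤ 0<xs)) (*-pos 0<x (e-pos xs m 0<xs m≤))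

  suc*e-suc≤∑ℚ*e : ∀ xs m → All (0ℚ ≤_) xs → ι (suc m) * e xs (suc m) ≤ ∑ℚ xs * e xs m
  suc*e-suc≤∑ℚ*e []       m       _ = ≤-reflexive (trans (*-zeroʳ (ι (suc m))) (sym (*-zeroˡ (e [] m))))
  suc*e-suc≤∑ℚ*e (x ∷ xs) zero    _ = ≤-reflexive (trans (cong (λ s → 1ℚ * (s + x * 1ℚ)) (e-1 xs)) (commute x (∑ℚ xs)))
    where
    commute : ∀ x s → 1ℚ * (s + x * 1ℚ) ≡ (x + s) * 1ℚ
    commute = solve 2 (λ x s → con 1ℚ :* (s :+ x :* con 1ℚ) := (x :+ s) :* con 1ℚ) refl
  suc*e-suc≤∑ℚ*e (x ∷ xs) (suc m) (0≤x ∷ 0≤xs) = begin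
    ι₂ * (e₂ + x * e₁)                        ≡⟨ *-distribˡ-+ ι₂ e₂ (x * e₁) ⟩
    ι₂ * e₂ + ι₂ * (x * e₁)                   ≡⟨ cong (λ i → ι₂ * e₂ + i * (x * e₁)) (ι-suc (suc m)) ⟩
    ι₂ * e₂ + (1ℚ + ι₁) * (x * e₁)            ≡⟨ distrib ι₂ e₂ ι₁ x e₁ ⟩
    ι₂ * e₂ + x * e₁ + x * (ι₁ * e₁)          ≤⟨ +-mono-≤ (+-monoˡ-≤ (x * e₁) (suc*e-suc≤∑ℚ*e xs (suc m) 0≤xs))
                                                           (*-monoˡ-≤ 0≤x (suc*e-suc≤∑ℚ*e xs m 0≤xs)) ⟩
    s * e₁ + x * e₁ + x * (s * e₀)            ≤⟨ ≤-+-nonNeg (*-nonNeg (*-nonNeg 0≤x 0≤x) (e-nonNeg xs m 0≤xs)) ⟩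
    s * e₁ + x * e₁ + x * (s * e₀) + x * x * e₀ ≡⟨ factor s e₁ x e₀ ⟩
    (x + s) * (e₁ + x * e₀)                   ∎
    where
    open ≤-Reasoning
    s = ∑ℚ xs
    ι₂ = ι (suc (suc m))
    ι₁ = ι (suc m)
    e₂ = e xs (suc (suc m))
    e₁ = e xs (suc m)
    e₀ = e xs m
    distrib : ∀ a b i x c → a * b + (1ℚ + i) * (x * c) ≡ a * b + x * c + x * (i * c)
    distrib = solve 5 (λ a b i x c → a :* b :+ (con 1ℚ :+ i) :* (x :* c) := a :* b :+ x :* c :+ x :* (i :* c)) refl
    factor : ∀ s e₁ x e₀ → s * e₁ + x * e₁ + x * (s * e₀) + x * x * e₀ ≡ (x + s) * (e₁ + x * e₀)
    factor = solve 4 (λ s e₁ x e₀ → s :* e₁ :+ x :* e₁ :+ x :* (s :* e₀) :+ x :* x :* e₀ := (x :+ s) :* (e₁ :+ x :* e₀)) refl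

  ∑ℚ-drop-≤ : ∀ {x} xs k → 0ℚ ≤ x → All (_≤ x) xs → ∑ℚ (drop k xs) ≤ x + ∑ℚ (drop (suc k) xs)
  ∑ℚ-drop-≤ {x} []    zero    0≤x _          = subst (0ℚ ≤_) (sym (+-identityʳ x)) 0≤x
  ∑ℚ-drop-≤ {x} []    (suc k) 0≤x _          = subst (0ℚ ≤_) (sym (+-identityʳ x)) 0≤x
  ∑ℚ-drop-≤ (y ∷ ys) zero    _   (y≤x ∷ _)  = +-monoˡ-≤ (∑ℚ ys) y≤x
  ∑ℚ-drop-≤ (y ∷ ys) (suc k) 0≤x (_ ∷ ys≤x) = ∑ℚ-drop-≤ ys k 0≤x ys≤x

  ∑ℚ-drop*e≤suc*e-suc : ∀ xs k → All (0ℚ ≤_) xs → AllPairs (λ x y → y ≤ x) xs →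
    ∑ℚ (drop k xs) * e xs k ≤ ι (suc k) * e xs (suc k)
  ∑ℚ-drop*e≤suc*e-suc []       zero    _ _ = ≤-reflexive (trans (*-zeroˡ 1ℚ) (sym (*-zeroʳ (ι 1))))
  ∑ℚ-drop*e≤suc*e-suc []       (suc k) _ _ = ≤-reflexive (trans (*-zeroˡ 0ℚ) (sym (*-zeroʳ (ι (suc (suc k))))))
  ∑ℚ-drop*e≤suc*e-suc (x ∷ xs) zero    _ _ =
    ≤-reflexive (trans (commute x (∑ℚ xs)) (cong (λ s → 1ℚ * (s + x * 1ℚ)) (sym (e-1 xs))))
    where
    commute : ∀ x s → (x + s) * 1ℚ ≡ 1ℚ * (s + x * 1ℚ)
    commute = solve 2 (λ x s → (x :+ s) :* con 1ℚ := con 1ℚ :* (s :+ x :* con 1ℚ)) refl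
  ∑ℚ-drop*e≤suc*e-suc (x ∷ xs) (suc k) (0≤x ∷ 0≤xs) (xs≤x ∷ sorted) = begin
    d₀ * (e₁ + x * e₀)                 ≡⟨ distrib₁ d₀ e₁ x e₀ ⟩
    d₀ * e₁ + x * (d₀ * e₀)            ≤⟨ +-mono-≤ (*-monoʳ-≤ (e-nonNeg xs (suc k) 0≤xs) (∑ℚ-drop-≤ xs k 0≤x xs≤x))
                                                   (*-monoˡ-≤ 0≤x (∑ℚ-drop*e≤suc*e-suc xs k 0≤xs sorted)) ⟩
    (x + d₁) * e₁ + x * (ι₁ * e₁)      ≡⟨ distrib₂ x d₁ e₁ ι₁ ⟩
    d₁ * e₁ + (x * e₁ + x * (ι₁ * e₁)) ≤⟨ +-monoˡ-≤ _ (∑ℚ-drop*e≤suc*e-suc xs (suc k) 0≤xs sorted) ⟩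
    ι₂ * e₂ + (x * e₁ + x * (ι₁ * e₁)) ≡⟨ distrib₃ ι₂ e₂ x e₁ ι₁ ⟩
    ι₂ * e₂ + (1ℚ + ι₁) * (x * e₁)     ≡⟨ cong (λ i → ι₂ * e₂ + i * (x * e₁)) (ι-suc (suc k)) ⟨
    ι₂ * e₂ + ι₂ * (x * e₁)            ≡⟨ *-distribˡ-+ ι₂ e₂ (x * e₁) ⟨
    ι₂ * (e₂ + x * e₁)                 ∎
    where
    open ≤-Reasoning
    d₀ = ∑ℚ (drop k xs)
    d₁ = ∑ℚ (drop (suc k) xs)
    ι₂ = ι (suc (suc k))
    ι₁ = ι (suc k)
    e₂ = e xs (suc (suc k))
    e₁ = e xs (suc k)
    e₀ = e xs k
    distrib₁ : ∀ d e₁ x e₀ → d * (e₁ + x * e₀) ≡ d * e₁ + x * (d * e₀)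
    distrib₁ = solve 4 (λ d e₁ x e₀ → d :* (e₁ :+ x :* e₀) := d :* e₁ :+ x :* (d :* e₀)) refl
    distrib₂ : ∀ x d e₁ i → (x + d) * e₁ + x * (i * e₁) ≡ d * e₁ + (x * e₁ + x * (i * e₁))
    distrib₂ = solve 4 (λ x d e₁ i → (x :+ d) :* e₁ :+ x :* (i :* e₁) := d :* e₁ :+ (x :* e₁ :+ x :* (i :* e₁))) refl
    distrib₃ : ∀ a b x c i → a * b + (x * c + x * (i * c)) ≡ a * b + (1ℚ + i) * (x * c)
    distrib₃ = solve 5 (λ a b x c i → a :* b :+ (x :* c :+ x :* (i :* c)) := a :* b :+ (con 1ℚ :+ i) :* (x :* c)) refl

  ∑ℚ-drop-pos : ∀ xs k → All (0ℚ <_) xs → k ℕ.< length xs → 0ℚ < ∑ℚ (drop k xs)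
  ∑ℚ-drop-pos (x ∷ xs) zero    (0<x ∷ 0<xs) _         =
    subst (0ℚ <_) (+-comm (∑ℚ xs) x) (+-nonNeg-pos (∑ℚ-nonNeg xs (All.map <⇒≤ 0<xs)) 0<x)
  ∑ℚ-drop-pos (x ∷ xs) (suc k) (_ ∷ 0<xs)   (s≤s k<n) = ∑ℚ-drop-pos xs k 0<xs k<n

  ∑ℚ-++-∸ : ∀ ys zs → ∑ℚ (ys ++ zs) - ∑ℚ ys ≡ ∑ℚ (drop (length ys) (ys ++ zs))
  ∑ℚ-++-∸ []       zs = solve 1 (λ s → s :- con 0ℚ := s) refl (∑ℚ zs)
  ∑ℚ-++-∸ (y ∷ ys) zs = trans (cancel y (∑ℚ (ys ++ zs)) (∑ℚ ys)) (∑ℚ-++-∸ ys zs)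
    where
    cancel : ∀ y s t → (y + s) - (y + t) ≡ s - t
    cancel = solve 3 (λ y s t → (y :+ s) :- (y :+ t) := s :- t) refl

module PrimesUpTo where

  open import Data.Nat using (ℕ; zero; suc; _+_; _∸_; _≤_; _<_; s≤s)
  open import Data.Nat.Properties using (+-identityʳ; +-suc; m+[n∸m]≡n; m≤m+n; ≤-total; <⇒≱)
  open import Data.Sum using (inj₁; inj₂)
  open import Data.Nat.Primality using (Prime; prime?)
  open import Data.Nat.Divisibility using (_∣?_)
  open import Data.List using (List; []; _∷_; _++_; [_]; filter; length)
  open import Data.List.Properties using (++-identityʳ; ++-assoc; filter-++; length-++; map-upTo)
  open import Data.List.Relation.Unary.All using (All)
  open import Data.List.Relation.Unary.All.Properties using (all-filter)
  open import Data.List.Relation.Unary.AllPairs using (AllPairs)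
  import Data.List.Relation.Unary.AllPairs.Properties as AllPairs
  open import Data.Product using (∃; _,_)
  open import Relation.Nullary using (yes; no; contradiction)
  open import Relation.Nullary.Decidable using (_×-dec_)
  open import Relation.Binary.PropositionalEquality hiding ([_])
  open import Defs using (oneTo; primeCount; ωUpTo)
  open PeriodicDensity using (oneTo-suc)
  open ExactDivisorCount using (ω)
  open ≡-Reasoning

  primesUpTo : ℕ → List ℕ
  primesUpTo q = filter prime? (oneTo q)

  primesUpTo-prime : ∀ q → All Prime (primesUpTo q)
  primesUpTo-prime q = all-filter prime? (oneTo q)

  primesUpTo-sorted : ∀ q → AllPairs _<_ (primesUpTo q)
  primesUpTo-sorted q = AllPairs.filter⁺ prime? (subst (AllPairs _<_) (sym (map-upTo suc q))
    (AllPairs.applyUpTo⁺₁ suc q (λ i<j _ → s≤s i<j)))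

  oneTo-+ : ∀ y d → ∃ λ R → oneTo (y + d) ≡ oneTo y ++ R
  oneTo-+ y zero    = [] , trans (cong oneTo (+-identityʳ y)) (sym (++-identityʳ (oneTo y)))
  oneTo-+ y (suc d) with oneTo-+ y d
  ... | R , oneTo[y+d]≡ = R ++ [ suc (y + d) ] , (begin
    oneTo (y + suc d)                ≡⟨ cong oneTo (+-suc y d) ⟩
    oneTo (suc (y + d))              ≡⟨ oneTo-suc (y + d) ⟩
    oneTo (y + d) ++ [ suc (y + d) ] ≡⟨ cong (_++ [ suc (y + d) ]) oneTo[y+d]≡ ⟩
    (oneTo y ++ R) ++ [ suc (y + d) ] ≡⟨ ++-assoc (oneTo y) R _ ⟩
    oneTo y ++ (R ++ [ suc (y + d) ]) ∎)

  primesUpTo-++ : ∀ {y q} → y ≤ q → ∃ λ R → primesUpTo q ≡ primesUpTo y ++ R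
  primesUpTo-++ {y} {q} y≤q with oneTo-+ y (q ∸ y)
  ... | R , oneTo≡ = filter prime? R ,
    trans (cong (filter prime?) (trans (cong oneTo (sym (m+[n∸m]≡n y≤q))) oneTo≡)) (filter-++ prime? (oneTo y) R)

  primeCount-mono : ∀ {y q} → y ≤ q → primeCount y ≤ primeCount q
  primeCount-mono {y} {q} y≤q with primesUpTo-++ y≤q
  ... | R , ps≡ = subst (primeCount y ≤_) (trans (sym (length-++ (primesUpTo y))) (cong length (sym ps≡)))
                        (m≤m+n (primeCount y) (length R))

  primeCount-<⇒≤ : ∀ {y q} → primeCount y < primeCount q → y ≤ q
  primeCount-<⇒≤ {y} {q} πy<πq with ≤-total y q
  ... | inj₁ y≤q = y≤q
  ... | inj₂ q≤y = contradiction (primeCount-mono q≤y) (<⇒≱ πy<πq)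

  ωUpTo≡ω : ∀ q n → ωUpTo q n ≡ ω (primesUpTo q) n
  ωUpTo≡ω q n = filter-× (oneTo q)
    where
    filter-× : ∀ xs → length (filter (λ p → prime? p ×-dec p ∣? n) xs) ≡ ω (filter prime? xs) n
    filter-× []       = refl
    filter-× (x ∷ xs) with prime? x
    ... | no _  = filter-× xs
    ... | yes _ with x ∣? n
    ...   | yes _ = cong suc (filter-× xs)
    ...   | no _  = filter-× xs

module DensityFormula where

  open import Data.Nat as ℕ using (ℕ; zero; suc; _∸_; s≤s)
  import Data.Nat.Properties as ℕ
  open import Data.Nat.ListAction using (product)
  open import Data.Nat.ListAction.Properties using (product≢0)
  open import Data.Nat.Divisibility using (_∣_)
  open import Relation.Nullary using (¬_)
  open import Data.Nat.Primality using (Prime; ¬prime[0]; ¬prime[1]; productOfPrimes≥1)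
  open import Data.Integer using (+_)
  open import Data.Rational using (ℚ; 0ℚ; 1ℚ; _+_; _*_; _-_; _≤_; _<_; _/_)
  open import Data.Rational.Properties
  open import Data.Rational.Solver using (module +-*-Solver)
  open +-*-Solver using (solve; _:=_; _:+_; _:*_)
  open import Data.List using (List; []; _∷_; _++_; map; foldr; drop; length)
  open import Data.List.Properties using (length-map; map-++)
  open import Data.List.Relation.Unary.All as All using (All; []; _∷_)
  import Data.List.Relation.Unary.All.Properties as All
  open import Data.Product using (_,_)
  open import Data.List.Relation.Unary.AllPairs using (AllPairs; []; _∷_)
  open import Data.Empty using (⊥-elim)
  open import Relation.Binary.PropositionalEquality
  open import Defs
  open FiniteSums
  open PeriodicDensity
  open ExactDivisorCount
  open RationalFacts
  open ElementarySymmetric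
  open PrimesUpTo

  -- x_p = 1/(p − 1); the value at p < 2 is junk and never used.
  inv∸1 : ℕ → ℚ
  inv∸1 (suc (suc k)) = + 1 / suc k
  inv∸1 _             = 0ℚ

  A≡∑ℚ : ∀ y → A y ≡ ∑ℚ (map inv∸1 (primesUpTo y))
  A≡∑ℚ y = foldr-inv∸1 (primesUpTo y) refl λ { zero _ → refl ; (suc zero) _ → refl ; (suc (suc _)) _ → refl }
    where
    -- A folds with a step function local to its definition; refl lets unification supply it as g.
    foldr-inv∸1 : ∀ {g : ℕ → ℚ → ℚ} L {a} → a ≡ foldr g 0ℚ L → (∀ p s → g p s ≡ inv∸1 p + s) → a ≡ ∑ℚ (map inv∸1 L)
    foldr-inv∸1 []      a≡ _  = a≡
    foldr-inv∸1 (p ∷ L) a≡ g≡ = trans a≡ (trans (g≡ p _) (cong (λ t → inv∸1 p + t) (foldr-inv∸1 L refl g≡)))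

  -- Euler's totient of product L when L consists of distinct primes.
  φ : List ℕ → ℕ
  φ L = product (map ℕ.pred L)

  countExactly≡φ*e : ∀ L m → AllPairs ℕ._<_ L → All Prime L → ι (countExactly L m) ≡ ι (φ L) * e (map inv∸1 L) m
  countExactly≡φ*e []                  zero    _ _ = sym (*-identityʳ (ι 1))
  countExactly≡φ*e []                  (suc m) _ _ = sym (*-zeroʳ (ι 1))
  countExactly≡φ*e (zero        ∷ L) m _ (0-prime ∷ _) = ⊥-elim (¬prime[0] 0-prime)
  countExactly≡φ*e (suc zero    ∷ L) m _ (1-prime ∷ _) = ⊥-elim (¬prime[1] 1-prime)
  countExactly≡φ*e (suc (suc k) ∷ L) zero (p<L ∷ L-sorted) (p-prime ∷ L-prime) = begin
    ι (countExactly (p ∷ L) 0)                 ≡⟨ cong ι (countExactly-∷ L 0 p-prime p∤M) ⟩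
    ι (∑[ a < product L ] 0 ℕ.+ suc k ℕ.* c₀)  ≡⟨ cong (λ t → ι (t ℕ.+ suc k ℕ.* c₀)) (∑<-zero (product L) (λ _ _ → refl)) ⟩
    ι (suc k ℕ.* c₀)                           ≡⟨ ι-* (suc k) c₀ ⟩
    s * ι c₀                                   ≡⟨ cong (s *_) (countExactly≡φ*e L 0 L-sorted L-prime) ⟩
    s * (D * 1ℚ)                               ≡⟨ *-assoc s D 1ℚ ⟨
    s * D * 1ℚ                                 ≡⟨ cong (_* 1ℚ) (ι-* (suc k) (φ L)) ⟨
    ι (φ (p ∷ L)) * 1ℚ                         ∎
    where
    open ≡-Reasoning
    p = suc (suc k)
    s = ι (suc k)
    D = ι (φ L)
    c₀ = countExactly L 0
    p∤M : ¬ p ∣ product L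
    p∤M = prime∤product L p-prime L-prime p<L
  countExactly≡φ*e (suc (suc k) ∷ L) (suc m) (p<L ∷ L-sorted) (p-prime ∷ L-prime) = begin
    ι (countExactly (p ∷ L) (suc m))           ≡⟨ cong ι (countExactly-∷ L (suc m) p-prime p∤M) ⟩
    ι (c₀ ℕ.+ suc k ℕ.* c₁)                    ≡⟨ trans (ι-+ c₀ _) (cong (λ t → ι c₀ + t) (ι-* (suc k) c₁)) ⟩
    ι c₀ + s * ι c₁                            ≡⟨ cong₂ (λ a b → a + s * b) (countExactly≡φ*e L m L-sorted L-prime)
                                                                          (countExactly≡φ*e L (suc m) L-sorted L-prime) ⟩
    D * e₀ + s * (D * e₁)                      ≡⟨ cong (_+ s * (D * e₁)) (*-identityˡ (D * e₀)) ⟨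
    1ℚ * (D * e₀) + s * (D * e₁)               ≡⟨ cong (λ t → t * (D * e₀) + s * (D * e₁)) (ι*1/≡1 k) ⟨
    s * x * (D * e₀) + s * (D * e₁)            ≡⟨ factor s x D e₀ e₁ ⟩
    s * D * (e₁ + x * e₀)                      ≡⟨ cong (_* (e₁ + x * e₀)) (ι-* (suc k) (φ L)) ⟨
    ι (φ (p ∷ L)) * (e₁ + x * e₀)              ∎
    where
    open ≡-Reasoning
    p = suc (suc k)
    s = ι (suc k)
    x = + 1 / suc k
    D = ι (φ L)
    e₀ = e (map inv∸1 L) m
    e₁ = e (map inv∸1 L) (suc m)
    c₀ = countExactly L m
    c₁ = countExactly L (suc m)
    p∤M : ¬ p ∣ product L
    p∤M = prime∤product L p-prime L-prime p<L
    factor : ∀ s x D e₀ e₁ → s * x * (D * e₀) + s * (D * e₁) ≡ s * D * (e₁ + x * e₀)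
    factor = solve 5 (λ s x D e₀ e₁ → s :* x :* (D :* e₀) :+ s :* (D :* e₁) := s :* D :* (e₁ :+ x :* e₀)) refl

  inv∸1-pos : ∀ {p} → Prime p → 0ℚ < inv∸1 p
  inv∸1-pos {suc (suc k)} _ = 1/suc-pos k

  map-inv∸1-pos : ∀ {L} → All Prime L → All (0ℚ <_) (map inv∸1 L)
  map-inv∸1-pos L-prime = All.map⁺ (All.map inv∸1-pos L-prime)

  map-inv∸1-antitone : ∀ {L} → AllPairs ℕ._<_ L → All Prime L → AllPairs (λ x y → y ≤ x) (map inv∸1 L)
  map-inv∸1-antitone {[]}    []               []                  = []
  map-inv∸1-antitone {p ∷ L} (p<L ∷ L-sorted) (p-prime ∷ L-prime) =
    All.map⁺ (All.map (antitone p-prime) p<L) ∷ map-inv∸1-antitone L-sorted L-prime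
    where
    antitone : ∀ {p p′} → Prime p → p ℕ.< p′ → inv∸1 p′ ≤ inv∸1 p
    antitone {suc (suc k)} {suc (suc k′)} _ (s≤s (s≤s k<k′)) = 1/suc-antitone (ℕ.<⇒≤ k<k′)

  A-gap : ∀ {y q} → y ℕ.≤ q → A q - A y ≡ ∑ℚ (drop (primeCount y) (map inv∸1 (primesUpTo q)))
  A-gap {y} {q} y≤q with primesUpTo-++ y≤q
  ... | R , ps≡ = begin
    A q - A y                                     ≡⟨ cong₂ _-_ (A≡∑ℚ q) (A≡∑ℚ y) ⟩
    ∑ℚ (map inv∸1 (primesUpTo q)) - ∑ℚ xy         ≡⟨ cong (λ l → ∑ℚ l - ∑ℚ xy) map≡ ⟩
    ∑ℚ (xy ++ map inv∸1 R) - ∑ℚ xy                ≡⟨ ∑ℚ-++-∸ xy (map inv∸1 R) ⟩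
    ∑ℚ (drop (length xy) (xy ++ map inv∸1 R))     ≡⟨ cong₂ (λ n l → ∑ℚ (drop n l)) (length-map inv∸1 (primesUpTo y)) (sym map≡) ⟩
    ∑ℚ (drop (primeCount y) (map inv∸1 (primesUpTo q))) ∎
    where
    open ≡-Reasoning
    xy = map inv∸1 (primesUpTo y)
    map≡ : map inv∸1 (primesUpTo q) ≡ xy ++ map inv∸1 R
    map≡ = trans (cong (map inv∸1) ps≡) (map-++ inv∸1 (primesUpTo y) R)

  φ-nonZero : ∀ {L} → All Prime L → ℕ.NonZero (φ L)
  φ-nonZero L-prime = product≢0 (All.map⁺ (All.map pred-nonZero L-prime))
    where
    pred-nonZero : ∀ {p} → Prime p → ℕ.NonZero (ℕ.pred p)
    pred-nonZero {suc (suc _)} _ = _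

  module Density (q : ℕ) where

    L : List ℕ
    L = primesUpTo q

    xs : List ℚ
    xs = map inv∸1 L

    M-1 : ℕ
    M-1 = product L ∸ 1

    private
      L-sorted : AllPairs ℕ._<_ L
      L-sorted = primesUpTo-sorted q

      L-prime : All Prime L
      L-prime = primesUpTo-prime q

    xs-pos : All (0ℚ <_) xs
    xs-pos = map-inv∸1-pos L-prime

    length-xs : length xs ≡ primeCount q
    length-xs = length-map inv∸1 L

    M≡ : product L ≡ suc M-1
    M≡ = sym (ℕ.m+[n∸m]≡n (productOfPrimes≥1 L-prime))

    δ : ℕ → ℚ
    δ m = (+ countExactly L m) / suc M-1

    δ-density : ∀ m → IsNaturalDensity (ExactlyDiv? m q) (δ m)
    δ-density m = subst (λ c → IsNaturalDensity (ExactlyDiv? m q) ((+ c) / suc M-1)) ∑<G≡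
      (periodic-density (ExactlyDiv? m q) G M-1 count≡∑G (λ k → 𝟙≤1 (ω L (suc k) ℕ.≟ m)) G-periodic)
      where
      G : ℕ → ℕ
      G k = 𝟙 (ω L (suc k) ℕ.≟ m)
      L∣M : All (_∣ suc M-1) L
      L∣M = subst (λ M → All (_∣ M) L) M≡ (∣-product L)
      count≡∑G : ∀ x → countUpTo (ExactlyDiv? m q) x ≡ ∑< x G
      count≡∑G x = trans (countUpTo≡∑𝟙 (ExactlyDiv? m q) x) (∑<-cong x (λ k _ → cong (λ i → 𝟙 (i ℕ.≟ m)) (ωUpTo≡ω q (suc k))))
      G-periodic : ∀ j → G (suc M-1 ℕ.+ j) ≡ G j
      G-periodic j = cong (λ i → 𝟙 (i ℕ.≟ m))
        (trans (cong (ω L) (sym (ℕ.+-suc (suc M-1) j))) (ω-+-period L (suc M-1) (suc j) L∣M))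
      ∑<G≡ : ∑< (suc M-1) G ≡ countExactly L m
      ∑<G≡ = trans (∑<-suc-shift (suc M-1) (λ n → 𝟙 (ω L n ℕ.≟ m))
                     (cong (λ i → 𝟙 (i ℕ.≟ m)) (trans (cong (ω L) (sym (ℕ.+-identityʳ (suc M-1)))) (ω-+-period L (suc M-1) 0 L∣M))))
                   (cong (λ M → ∑< M (λ n → 𝟙 (ω L n ℕ.≟ m))) (sym M≡))

    c : ℚ
    c = ι (φ L) * (+ 1 / suc M-1)

    c>0 : 0ℚ < c
    c>0 = *-pos (ι-pos (φ L) {{φ-nonZero L-prime}}) (1/suc-pos M-1)

    δ≡c*e : ∀ m → δ m ≡ c * e xs m
    δ≡c*e m = begin
      (+ countExactly L m) / suc M-1           ≡⟨ /≡ι*1/ (countExactly L m) M-1 ⟩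
      ι (countExactly L m) * (+ 1 / suc M-1)   ≡⟨ cong (_* (+ 1 / suc M-1)) (countExactly≡φ*e L m L-sorted L-prime) ⟩
      ι (φ L) * e xs m * (+ 1 / suc M-1)       ≡⟨ swap (ι (φ L)) (e xs m) (+ 1 / suc M-1) ⟩
      c * e xs m                               ∎
      where
      open ≡-Reasoning
      swap : ∀ a b c → a * b * c ≡ a * c * b
      swap = solve 3 (λ a b c → a :* b :* c := a :* c :* b) refl

    δ-pos : ∀ m → m ℕ.≤ length xs → 0ℚ < δ m
    δ-pos m m≤n = subst (0ℚ <_) (sym (δ≡c*e m)) (*-pos c>0 (e-pos xs m xs-pos m≤n))

    private
      xs-nonNeg : All (0ℚ ≤_) xs
      xs-nonNeg = All.map <⇒≤ xs-pos

      xs-antitone : AllPairs (λ x y → y ≤ x) xs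
      xs-antitone = map-inv∸1-antitone L-sorted L-prime

      pull : ∀ a c u → a * (c * u) ≡ c * (a * u)
      pull = solve 3 (λ a c u → a :* (c :* u) := c :* (a :* u)) refl

      push : ∀ c a u → c * (a * u) ≡ c * u * a
      push = solve 3 (λ c a u → c :* (a :* u) := c :* u :* a) refl

    δ-lower : ∀ m → ι (suc m) * δ (suc m) ≤ δ m * ∑ℚ xs
    δ-lower m = begin
      ι (suc m) * δ (suc m)           ≡⟨ cong (ι (suc m) *_) (δ≡c*e (suc m)) ⟩
      ι (suc m) * (c * e xs (suc m))  ≡⟨ pull (ι (suc m)) c (e xs (suc m)) ⟩
      c * (ι (suc m) * e xs (suc m))  ≤⟨ *-monoˡ-≤ (<⇒≤ c>0) (suc*e-suc≤∑ℚ*e xs m xs-nonNeg) ⟩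
      c * (∑ℚ xs * e xs m)            ≡⟨ push c (∑ℚ xs) (e xs m) ⟩
      c * e xs m * ∑ℚ xs              ≡⟨ cong (_* ∑ℚ xs) (δ≡c*e m) ⟨
      δ m * ∑ℚ xs                     ∎
      where open ≤-Reasoning

    δ-upper : ∀ m → δ m * ∑ℚ (drop m xs) ≤ ι (suc m) * δ (suc m)
    δ-upper m = begin
      δ m * ∑ℚ (drop m xs)            ≡⟨ cong (_* ∑ℚ (drop m xs)) (δ≡c*e m) ⟩
      c * e xs m * ∑ℚ (drop m xs)     ≡⟨ push c (∑ℚ (drop m xs)) (e xs m) ⟨
      c * (∑ℚ (drop m xs) * e xs m)   ≤⟨ *-monoˡ-≤ (<⇒≤ c>0) (∑ℚ-drop*e≤suc*e-suc xs m xs-nonNeg xs-antitone) ⟩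
      c * (ι (suc m) * e xs (suc m))  ≡⟨ pull (ι (suc m)) c (e xs (suc m)) ⟨
      ι (suc m) * (c * e xs (suc m))  ≡⟨ cong (ι (suc m) *_) (δ≡c*e (suc m)) ⟨
      ι (suc m) * δ (suc m)           ∎
      where open ≤-Reasoning

open import Defs
open import Data.Nat using (ℕ; _≤_; _∸_)
open import Data.Integer using (+_)
open import Data.Rational using (ℚ; 0ℚ; _<_; _-_; _/_)
open import Data.Rational using () renaming (_≤_ to _≤ℚ_)
open import Data.Product using (Σ; _×_)
open import Relation.Binary.PropositionalEquality using (_≡_)

open import Data.Nat as ℕ using (suc; s≤s; z≤n)
import Data.Nat.Properties as ℕ
open import Data.Rational using (_*_)
open import Data.List using (length; drop)
open import Data.Product using (_,_)
open import Relation.Binary.PropositionalEquality using (sym; trans; cong; subst; subst₂)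
open RationalFacts using (ι; divPos-≤-crossMul)
open ElementarySymmetric using (∑ℚ; ∑ℚ-drop-pos)
open PrimesUpTo using (primeCount-<⇒≤)
open DensityFormula

lemma2 : (r i q y : ℕ) → 1 ≤ r → r ≤ i → IsNthPrime i q → primeCount y ≡ r ∸ 1 →
    Σ ℚ λ δr → Σ ℚ λ δr-1 →
      IsNaturalDensity (ExactlyDiv? r q) δr × IsNaturalDensity (ExactlyDiv? (r ∸ 1) q) δr-1 ×
      Σ (0ℚ < δr) λ δr>0 → Σ (0ℚ < A q) λ Aq>0 → Σ (0ℚ < A q - A y) λ gap>0 →
        (divPos (+ r / 1) (A q) Aq>0 ≤ℚ divPos δr-1 δr δr>0)
        × (divPos δr-1 δr δr>0 ≤ℚ divPos (+ r / 1) (A q - A y) gap>0)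
lemma2 (suc k) i q y _ r≤i (_ , πq≡i) πy≡k =
  δ (suc k) , δ k , δ-density (suc k) , δ-density k , δr>0 , Aq>0 , gap>0 ,
  divPos-≤-crossMul (ι (suc k)) (δ k) Aq>0 δr>0 (subst (λ a → ι (suc k) * δ (suc k) ≤ℚ δ k * a) (sym Aq≡) (δ-lower k)) ,
  divPos-≤-crossMul (δ k) (ι (suc k)) δr>0 gap>0 (subst (λ g → δ k * g ≤ℚ ι (suc k) * δ (suc k)) (sym gap≡) (δ-upper k))
  where
  open Density q
  r≤|xs| : suc k ≤ length xs
  r≤|xs| = subst (suc k ≤_) (sym (trans length-xs πq≡i)) r≤i
  δr>0 : 0ℚ < δ (suc k)
  δr>0 = δ-pos (suc k) r≤|xs|
  Aq≡ : A q ≡ ∑ℚ xs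
  Aq≡ = A≡∑ℚ q
  y≤q : y ≤ q
  y≤q = primeCount-<⇒≤ {y} {q} (subst₂ ℕ._<_ (sym πy≡k) (sym πq≡i) r≤i)
  gap≡ : A q - A y ≡ ∑ℚ (drop k xs)
  gap≡ = trans (A-gap y≤q) (cong (λ n → ∑ℚ (drop n xs)) πy≡k)
  Aq>0 : 0ℚ < A q
  Aq>0 = subst (0ℚ <_) (sym Aq≡) (∑ℚ-drop-pos xs 0 xs-pos (ℕ.≤-trans (s≤s z≤n) r≤|xs|))
  gap>0 : 0ℚ < A q - A y
  gap>0 = subst (0ℚ <_) (sym gap≡) (∑ℚ-drop-pos xs k xs-pos r≤|xs|)
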